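{- Let $G$ be a graph with vertex set $\{v_1,\ldots,v_n\}$ and $H$ a graph with root $v\in V(H)$. For $k\in[n]$ let $F_k$ be the subgraph of $G\circ_v H$ induced by $V(G)\cup V(H_k)$, and let $F\in\{F_1,\ldots,F_n\}$ satisfy $\chi_i(F)=\max_{k\in[n]}\chi_i(F_k)$. Then $$\chi_i(F)\in\{\chi_i(G),\ \chi_i(H),\ \chi_i(G)+1,\ \chi_i(H)+1,\ \Delta(G)+d_H(v),\ \Delta(G)+d_H(v)+1\}.$$
   Context: An injective $k$-coloring of a graph is a map $f:V\to\{1,\dots,k\}$ such that no vertex has two neighbors $u\neq w$ with $f(u)=f(w)$; $\chi_i$ denotes the least such $k$. For a graph $G$ with $V(G)=\{v_1,\ldots,v_n\}$ and a graph $H$ with root $v$, the rooted product $G\circ_v H$ has vertex set $V(G)\times V(H)$ and edge set $\bigcup_{i=1}^n\{(v_i,h)(v_i,h') : hh'\in E(H)\}\cup\{(v_i,v)(v_j,v): v_iv_j\in E(G)\}$; i.e., it is obtained by taking $n$ copies $H_1,\ldots,H_n$ of $H$ (with $V(H_i)=\{v_i\}\times V(H)$) and identifying the root of $H_i$ with $v_i$; $V(G)$ is identified with $\{(v_i,v)\}$. $\Delta(G)$ is the maximum degree of $G$ and $d_H(v)$ the degree of $v$ in $H$. -}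

module Defs where

open import Data.Bool using (Bool; true; false; _∧_; _∨_; if_then_else_; T)
open import Data.Nat using (ℕ; _⊔_; _+_; _≤_)
open import Data.Fin using (Fin; _≟_)
open import Data.List using (List; map; foldr; allFin)
open import Data.Nat.ListAction using (sum)
open import Data.Product using (Σ; _×_; _,_; proj₁; proj₂)
open import Relation.Nullary.Decidable using (⌊_⌋)
open import Relation.Binary.PropositionalEquality using (_≡_)

Graph : Set → Set
Graph V = V → V → Bool

Adj : {V : Set} → Graph V → V → V → Set
Adj G u w = G u w ≡ true

record IsSimple {V : Set} (G : Graph V) : Set where
  field
    symm  : ∀ u w → G u w ≡ G w u
    irrfl : ∀ u → G u u ≡ false

IsInjColoring : {V : Set} → Graph V → (k : ℕ) → (V → Fin k) → Set
IsInjColoring {V} G k f =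
  ∀ (x u w : V) → Adj G x u → Adj G x w → f u ≡ f w → u ≡ w

InjColorable : {V : Set} → Graph V → ℕ → Set
InjColorable {V} G k = Σ (V → Fin k) (IsInjColoring G k)

IsInjChrom : {V : Set} → Graph V → ℕ → Set
IsInjChrom G c = InjColorable G c × (∀ k → InjColorable G k → c ≤ k)

deg : {n : ℕ} → Graph (Fin n) → Fin n → ℕ
deg {n} G x = sum (map (λ y → if G x y then 1 else 0) (allFin n))

maxDeg : {n : ℕ} → Graph (Fin n) → ℕ
maxDeg {n} G = foldr _⊔_ 0 (map (deg G) (allFin n))

eqᵇ : {n : ℕ} → Fin n → Fin n → Bool
eqᵇ i j = ⌊ i ≟ j ⌋

rootedProduct : {n m : ℕ} → Graph (Fin n) → Graph (Fin m) → Fin m → Graph (Fin n × Fin m)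
rootedProduct G H r (i , h) (j , h') =
  (eqᵇ i j ∧ H h h') ∨ (eqᵇ h r ∧ (eqᵇ h' r ∧ G i j))

-- vertex set of F_k : V(G) ∪ V(H_k)
inF : {n m : ℕ} → Fin m → Fin n → Fin n × Fin m → Bool
inF r k (i , h) = eqᵇ h r ∨ eqᵇ i k

VF : {n m : ℕ} → Fin m → Fin n → Set
VF {n} {m} r k = Σ (Fin n × Fin m) (λ p → T (inF r k p))

Fsub : {n m : ℕ} → Graph (Fin n) → Graph (Fin m) → (r : Fin m) → (k : Fin n) → Graph (VF r k)
Fsub G H r k (p , _) (q , _) = rootedProduct G H r p q

-- Let M = max(χ_i(G), χ_i(H), Δ(G) + d_H(v)). Every F_k contains copies of G and H, and the
-- vertex (v_k, v) has deg_G(v_k) + d_H(v) neighbours that need pairwise distinct colours;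
-- taking v_k of maximum degree, the maximality of χ_i(F) gives χ_i(F) ≥ M. Conversely every
-- F_k has an injective (M + 1)-colouring: colour G by an injective χ_i(G)-colouring, give
-- H_k an injective χ_i(H)-colouring recoloured by an injection that sends the colours of the
-- H-neighbours of the root away from those of the G-neighbours of v_k, and give the root of
-- H_k its colour from G, which is fresh in H_k. Hence χ_i(F) ∈ {M, M + 1}.
module Submission where

open import Defs
open import Data.Bool using (Bool; true; false; T; _∧_; _∨_; if_then_else_)
import Data.Bool.Properties as Bool
open import Data.Fin using (Fin; zero; suc; _≟_; punchIn; punchOut; inject≤; finToFun; funToFin)
open import Data.Fin.Properties
  using (any?; all?; *↔×; finToFun-funToFin; injective⇒≤; inject≤-injective;
         punchIn-injective; punchInᵢ≢i; punchOut-punchIn; punchOut-cong)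
open import Data.List using (List; []; _∷_; _++_; map; filter; lookup; length; allFin)
open import Data.List.Properties using (foldr-forcesᵇ; length-map; length-++)
open import Data.List.Membership.Propositional using (_∈_; _∉_)
open import Data.List.Membership.Propositional.Properties
  using (∈-lookup; ∈-filter⁺; ∈-allFin; ∈-map⁺; ∈-map⁻; foldr-selective)
open import Data.List.Relation.Unary.All as All using (All)
import Data.List.Relation.Unary.All.Properties as All
open import Data.List.Relation.Unary.AllPairs using (_∷_)
open import Data.List.Relation.Unary.Any as Any using (here; there; index)
open import Data.List.Relation.Unary.Any.Properties using (lookup-index)
open import Data.List.Relation.Binary.Disjoint.Propositional using (Disjoint)
open import Data.List.Relation.Unary.Unique.Propositional using (Unique)
import Data.List.Relation.Unary.Unique.Propositional.Properties as Unique
open import Data.Nat using (ℕ; zero; suc; _+_; _*_; _≤_; _<_; _⊔_; z≤n; s≤s; s≤s⁻¹)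
open import Data.Nat.Induction using (<-rec)
open import Data.Nat.ListAction using (sum)
open import Data.Nat.Properties
  using (≤-refl; ≤-reflexive; ≤-trans; ≤-antisym; ≮⇒≥; <⇒≱; m≤n⇒m≤1+n; m≤n⇒m<n∨m≡n;
         +-comm; +-monoˡ-≤; +-monoʳ-≤; +-mono-≤-<; +-mono-<-≤;
         ⊔-sel; ⊔-lub; m≤m⊔n; m≤n⊔m; m⊔n≤o⇒m≤o; m⊔n≤o⇒n≤o; anyUpTo?; module ≤-Reasoning)
open import Data.Product using (Σ; ∃; _×_; _,_; proj₁; proj₂)
open import Data.Sum using (_⊎_; inj₁; inj₂)
open import Data.Vec.Functional using (updateAt)
open import Data.Vec.Functional.Properties using (updateAt-updates; updateAt-minimal)
open import Function using (_∘_; const; Injective; _↪_; mk↪)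
open import Function.Bundles using (module RightInverse; module Equivalence)
open import Function.Construct.Composition using (_↪-∘_)
open import Function.Properties.Inverse using (↔-sym; ↔⇒↪)
open import Relation.Binary.Definitions using (DecidableEquality)
open import Relation.Binary.PropositionalEquality
open import Relation.Nullary using (Dec; yes; no; ¬?; contradiction)
open import Relation.Nullary.Decidable using (map′; _→-dec_; decidable-stable; toWitness; fromWitness)
open import Relation.Unary using (Decidable)

-- Searching finite and bounded domains

module _ {P : ℕ → Set} (P? : Decidable P) where

  leastWitness : ∀ {q} → P q → ∃ λ c → P c × (∀ k → P k → c ≤ k)
  leastWitness {q} = <-rec (λ q → P q → ∃ λ c → P c × (∀ k → P k → c ≤ k)) search q
    where
    search : ∀ q → (∀ {q′} → q′ < q → P q′ → ∃ λ c → P c × (∀ k → P k → c ≤ k)) →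
             P q → ∃ λ c → P c × (∀ k → P k → c ≤ k)
    search q rec Pq with anyUpTo? P? q
    ... | yes (q′ , q′<q , Pq′) = rec q′<q Pq′
    ... | no none               = q , Pq , λ k Pk → ≮⇒≥ (λ k<q → none (k , k<q , Pk))

∃-fun? : ∀ {N q} {P : (Fin N → Fin q) → Set} → (∀ {f g} → f ≗ g → P f → P g) →
         (∀ f → Dec (P f)) → Dec (∃ P)
∃-fun? resp P? =
  map′ (λ (t , Pt) → finToFun t , Pt)
       (λ (f , Pf) → funToFin f , resp (sym ∘ finToFun-funToFin f) Pf)
       (any? (P? ∘ finToFun))

∉-exists : ∀ {P} (L : List (Fin P)) → length L < P → ∃ (_∉ L)
∉-exists L |L|<P with any? (λ y → ¬? (Any.any? (y ≟_) L))
... | yes y∉L = y∉L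
... | no ∄∉   = contradiction (injective⇒≤ index-injective) (<⇒≱ |L|<P)
  where
  ∈L : ∀ y → y ∈ L
  ∈L y = decidable-stable (Any.any? (y ≟_) L) (λ y∉L → ∄∉ (y , y∉L))

  index-injective : Injective _≡_ _≡_ (index ∘ ∈L)
  index-injective {y} {y′} e =
    trans (lookup-index (∈L y)) (trans (cong (lookup L) e) (sym (lookup-index (∈L y′))))

lookup-injective : ∀ {A : Set} {xs : List A} → Unique xs → ∀ {i j} → lookup xs i ≡ lookup xs j → i ≡ j
lookup-injective (_ ∷ _)      {zero}  {zero}  _ = refl
lookup-injective (x∉xs ∷ _)   {zero}  {suc j} e = contradiction e (All.lookup x∉xs (∈-lookup j))
lookup-injective (x∉xs ∷ _)   {suc i} {zero}  e = contradiction (sym e) (All.lookup x∉xs (∈-lookup i))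
lookup-injective (_ ∷ unique) {suc i} {suc j} e = cong suc (lookup-injective unique e)

-- Injective colourings

module _ {V : Set} (Gr : Graph V) where

  injColoring-resp : ∀ {q} {f g : V → Fin q} → f ≗ g → IsInjColoring Gr q f → IsInjColoring Gr q g
  injColoring-resp f≗g col x u w xu xw gu≡gw =
    col x u w xu xw (trans (f≗g u) (trans gu≡gw (sym (f≗g w))))

  injColoring-∘ : ∀ {q q′} {f : V → Fin q} {τ : Fin q → Fin q′} → Injective _≡_ _≡_ τ →
                  IsInjColoring Gr q f → IsInjColoring Gr q′ (τ ∘ f)
  injColoring-∘ τ-injective col x u w xu xw τfu≡τfw = col x u w xu xw (τ-injective τfu≡τfw)

  injColoring-neighbourhood-≤ : ∀ {q f x} {xs : List V} → IsInjColoring Gr q f →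
                                Unique xs → All (Adj Gr x) xs → length xs ≤ q
  injColoring-neighbourhood-≤ {f = f} {x} {xs} col unique adj =
    injective⇒≤ {f = f ∘ lookup xs} λ {i} {j} e →
      lookup-injective unique (col x _ _ (All.lookup adj (∈-lookup i)) (All.lookup adj (∈-lookup j)) e)

injColoring-updateAt : ∀ {m q} {Gr : Graph (Fin m)} {f : Fin m → Fin q} {a} r →
                       IsInjColoring Gr q f → (∀ v → f v ≢ a) →
                       IsInjColoring Gr q (updateAt f r (const a))
injColoring-updateAt {f = f} {a} r col fresh x u w xu xw e with u ≟ r | w ≟ r
... | yes refl | yes refl = refl
... | yes refl | no w≢r   =
  contradiction (trans (sym (updateAt-minimal w r f w≢r)) (sym (trans (sym (updateAt-updates r f)) e))) (fresh w)
... | no u≢r   | yes refl =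
  contradiction (trans (sym (updateAt-minimal u r f u≢r)) (trans e (updateAt-updates r f))) (fresh u)
... | no u≢r   | no w≢r   =
  col x u w xu xw (trans (sym (updateAt-minimal u r f u≢r)) (trans e (updateAt-minimal w r f w≢r)))

injColorable-subgraph : ∀ {V W : Set} {G : Graph V} {H : Graph W} (e : W → V) → Injective _≡_ _≡_ e →
                        (∀ {u w} → Adj H u w → Adj G (e u) (e w)) →
                        ∀ {q} → InjColorable G q → InjColorable H q
injColorable-subgraph e e-injective e-adj (f , col) =
  f ∘ e , λ x u w xu xw e-col → e-injective (col (e x) (e u) (e w) (e-adj xu) (e-adj xw) e-col)

module _ {V : Set} {N : ℕ} (V↪Fin : V ↪ Fin N) where

  open RightInverse V↪Fin using (to; from; strictlyInverseʳ)

  _≟V_ : DecidableEquality V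
  u ≟V w = map′ (λ e → trans (sym (strictlyInverseʳ u)) (trans (cong from e) (strictlyInverseʳ w)))
                (cong to) (to u ≟ to w)

  ∀? : {P : V → Set} → Decidable P → Dec (∀ v → P v)
  ∀? {P} P? = map′ (λ ∀P v → subst P (strictlyInverseʳ v) (∀P (to v))) (λ ∀P i → ∀P (from i))
                   (all? (P? ∘ from))

  module _ (Gr : Graph V) where

    injColoring? : ∀ {q} (f : V → Fin q) → Dec (IsInjColoring Gr q f)
    injColoring? f = ∀? λ x → ∀? λ u → ∀? λ w →
      (Gr x u Bool.≟ true) →-dec (Gr x w Bool.≟ true) →-dec (f u ≟ f w) →-dec (u ≟V w)

    injColorable? : ∀ q → Dec (InjColorable Gr q)
    injColorable? q =
      map′ (λ (g , col) → g ∘ to , col)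
           (λ (f , col) → f ∘ from , injColoring-resp Gr (λ v → cong f (sym (strictlyInverseʳ v))) col)
           (∃-fun? (λ g≗h → injColoring-resp Gr (g≗h ∘ to)) (λ g → injColoring? (g ∘ to)))

    injChrom-exists : ∀ {q} → InjColorable Gr q → ∃ (IsInjChrom Gr)
    injChrom-exists = leastWitness injColorable?

Σ-T↪ : ∀ {A : Set} (p : A → Bool) → Σ A (T ∘ p) → Σ A (T ∘ p) ↪ A
Σ-T↪ {A} p default = mk↪ {to = proj₁} {from = restrict} λ { refl → restrict-proj₁ _ }
  where
  restrict : A → Σ A (T ∘ p)
  restrict a with Bool.T? (p a)
  ... | yes pa = a , pa
  ... | no _   = default

  restrict-proj₁ : ∀ v → restrict (proj₁ v) ≡ v
  restrict-proj₁ (a , pa) with Bool.T? (p a)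
  ... | yes pa′ = cong (a ,_) (Bool.T-irrelevant pa′ pa)
  ... | no ¬pa  = contradiction pa ¬pa

-- Degrees

sum-indicator≡length-filter : ∀ {A : Set} (p : A → Bool) (xs : List A) →
  sum (map (λ y → if p y then 1 else 0) xs) ≡ length (filter (λ y → p y Bool.≟ true) xs)
sum-indicator≡length-filter p [] = refl
sum-indicator≡length-filter p (x ∷ xs) with p x
... | true  = cong suc (sum-indicator≡length-filter p xs)
... | false = sum-indicator≡length-filter p xs

module _ {n : ℕ} (G : Graph (Fin n)) where

  neighbours : Fin n → List (Fin n)
  neighbours x = filter (λ y → G x y Bool.≟ true) (allFin n)

  length-neighbours : ∀ x → length (neighbours x) ≡ deg G x
  length-neighbours x = sym (sum-indicator≡length-filter (G x) (allFin n))

  neighbours-unique : ∀ x → Unique (neighbours x)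
  neighbours-unique x = Unique.filter⁺ _ (Unique.allFin⁺ n)

  neighbours-adj : ∀ x → All (Adj G x) (neighbours x)
  neighbours-adj x = All.all-filter _ (allFin n)

  ∈-neighbours⁺ : ∀ {x y} → Adj G x y → y ∈ neighbours x
  ∈-neighbours⁺ {x} {y} xy = ∈-filter⁺ (λ y → G x y Bool.≟ true) (∈-allFin y) xy

  deg≤maxDeg : ∀ x → deg G x ≤ maxDeg G
  deg≤maxDeg x = All.lookup (All.map⁻ degs≤maxDeg) (∈-allFin x)
    where
    degs≤maxDeg : All (_≤ maxDeg G) (map (deg G) (allFin n))
    degs≤maxDeg = foldr-forcesᵇ (λ a b a⊔b≤ → m⊔n≤o⇒m≤o a b a⊔b≤ , m⊔n≤o⇒n≤o a b a⊔b≤) 0 _ ≤-refl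

  maxDeg-attained : Fin n → ∃ λ x → maxDeg G ≤ deg G x
  maxDeg-attained x₀ with foldr-selective ⊔-sel 0 (map (deg G) (allFin n))
  ... | inj₁ maxDeg≡0 = x₀ , ≤-trans (≤-reflexive maxDeg≡0) z≤n
  ... | inj₂ maxDeg∈  = let x , _ , maxDeg≡deg = ∈-map⁻ (deg G) maxDeg∈ in x , ≤-reflexive maxDeg≡deg

-- Injections avoiding prescribed values

module _ {P : ℕ} (a : Fin (suc P)) where

  punchOutList : List (Fin (suc P)) → List (Fin P)
  punchOutList [] = []
  punchOutList (b ∷ bs) with a ≟ b
  ... | yes _   = punchOutList bs
  ... | no a≢b = punchOut a≢b ∷ punchOutList bs

  length-punchOutList-≤ : ∀ bs → length (punchOutList bs) ≤ length bs
  length-punchOutList-≤ [] = z≤n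
  length-punchOutList-≤ (b ∷ bs) with a ≟ b
  ... | yes _ = m≤n⇒m≤1+n (length-punchOutList-≤ bs)
  ... | no _  = s≤s (length-punchOutList-≤ bs)

  length-punchOutList-< : ∀ {bs} → a ∈ bs → length (punchOutList bs) < length bs
  length-punchOutList-< {b ∷ bs} a∈ with a ≟ b | a∈
  ... | yes _   | _          = s≤s (length-punchOutList-≤ bs)
  ... | no a≢b | here a≡b   = contradiction a≡b a≢b
  ... | no _   | there a∈bs = s≤s (length-punchOutList-< a∈bs)

  ∈-punchOutList⁺ : ∀ {z bs} → punchIn a z ∈ bs → z ∈ punchOutList bs
  ∈-punchOutList⁺ {z} {b ∷ bs} z∈ with a ≟ b | z∈
  ... | yes a≡b | here z≡b   = contradiction (trans z≡b (sym a≡b)) (punchInᵢ≢i a z)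
  ... | yes _   | there z∈bs = ∈-punchOutList⁺ z∈bs
  ... | no _    | here refl  = here (sym (trans (punchOut-cong a refl) (punchOut-punchIn a)))
  ... | no _    | there z∈bs = there (∈-punchOutList⁺ z∈bs)

module _ {q P : ℕ} where

  extendInjection : Fin (suc P) → (Fin q → Fin P) → Fin (suc q) → Fin (suc P)
  extendInjection y σ zero    = y
  extendInjection y σ (suc x) = punchIn y (σ x)

  extendInjection-injective : ∀ {y σ} → Injective _≡_ _≡_ σ → Injective _≡_ _≡_ (extendInjection y σ)
  extendInjection-injective         σ-inj {zero}  {zero}   _ = refl
  extendInjection-injective {y} {σ} σ-inj {zero}  {suc x}  e = contradiction (sym e) (punchInᵢ≢i y (σ x))
  extendInjection-injective {y} {σ} σ-inj {suc x} {zero}   e = contradiction e (punchInᵢ≢i y (σ x))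
  extendInjection-injective {y}     σ-inj {suc x} {suc x′} e = cong suc (σ-inj (punchIn-injective y _ _ e))

avoidingInjection : ∀ {q P} → q ≤ P → (S : List (Fin q)) (B : List (Fin P)) → length S + length B ≤ P →
                    Σ (Fin q → Fin P) λ σ → Injective _≡_ _≡_ σ × (∀ {x} → x ∈ S → σ x ∉ B)
avoidingInjection {zero}  _   _ _  _ = (λ ()) , (λ { {()} }) , λ { {()} }
avoidingInjection {suc q} q≤P S [] _ = (λ x → inject≤ x q≤P) , inject≤-injective q≤P q≤P _ _ , λ _ ()
avoidingInjection {suc q} {suc P} (s≤s q≤P) S B@(b ∷ _) |S|+|B|≤1+P = extend firstImage
  where
  -- σ 0 must avoid B when 0 ∈ S; otherwise it is taken inside B, so that B shrinks.
  GoodFirstImage : Fin (suc P) → Set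
  GoodFirstImage y = (zero ∈ S → y ∉ B) × length (punchOutList zero S) + length (punchOutList y B) ≤ P

  firstImage : Σ (Fin (suc P)) GoodFirstImage
  firstImage with Any.any? (zero ≟_) S
  ... | no 0∉S = b , (λ 0∈S → contradiction 0∈S 0∉S) ,
    s≤s⁻¹ (≤-trans (+-mono-≤-< (length-punchOutList-≤ zero S) (length-punchOutList-< b (here refl))) |S|+|B|≤1+P)
  ... | yes 0∈S =
    let y , y∉B = ∉-exists B (≤-trans (+-monoˡ-≤ (length B) (≤-trans (s≤s z≤n) (length-punchOutList-< zero 0∈S)))
                                     |S|+|B|≤1+P)
    in y , (λ _ → y∉B) ,
       s≤s⁻¹ (≤-trans (+-mono-<-≤ (length-punchOutList-< zero 0∈S) (length-punchOutList-≤ y B)) |S|+|B|≤1+P)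

  extend : Σ (Fin (suc P)) GoodFirstImage →
           Σ (Fin (suc q) → Fin (suc P)) λ σ → Injective _≡_ _≡_ σ × (∀ {x} → x ∈ S → σ x ∉ B)
  extend (y , y-avoids , shrinks)
    with σ , σ-injective , σ-avoids ← avoidingInjection q≤P (punchOutList zero S) (punchOutList y B) shrinks
    = extendInjection y σ , extendInjection-injective σ-injective , avoids
    where
    avoids : ∀ {x} → x ∈ S → extendInjection y σ x ∉ B
    avoids {zero}  0∈S       = y-avoids 0∈S
    avoids {suc x} x+1∈S σx∈ = σ-avoids (∈-punchOutList⁺ zero x+1∈S) (∈-punchOutList⁺ y σx∈)

freshInjection : ∀ {q P} → q ≤ P → (a : Fin (suc P)) (S : List (Fin q)) (B : List (Fin (suc P))) →
                 length S + length B ≤ P →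
                 Σ (Fin q → Fin (suc P)) λ τ →
                   Injective _≡_ _≡_ τ × (∀ x → τ x ≢ a) × (∀ {x} → x ∈ S → τ x ∉ B)
freshInjection q≤P a S B |S|+|B|≤P
  with σ , σ-injective , σ-avoids ← avoidingInjection q≤P S (punchOutList a B)
         (≤-trans (+-monoʳ-≤ (length S) (length-punchOutList-≤ a B)) |S|+|B|≤P)
  = punchIn a ∘ σ , σ-injective ∘ punchIn-injective a _ _ , (λ x → punchInᵢ≢i a (σ x)) ,
    λ x∈S τx∈B → σ-avoids x∈S (∈-punchOutList⁺ a τx∈B)

-- The rooted product

∨-true⁻ : ∀ {x y} → x ∨ y ≡ true → x ≡ true ⊎ y ≡ true
∨-true⁻ {true}  _   = inj₁ refl
∨-true⁻ {false} y≡t = inj₂ y≡t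

∧-true⁻ : ∀ {x y} → x ∧ y ≡ true → x ≡ true × y ≡ true
∧-true⁻ {true} y≡t = refl , y≡t

eqᵇ-refl : ∀ {n} (i : Fin n) → eqᵇ i i ≡ true
eqᵇ-refl i = Equivalence.to Bool.T-≡ (fromWitness refl)

eqᵇ⇒≡ : ∀ {n} {i j : Fin n} → eqᵇ i j ≡ true → i ≡ j
eqᵇ⇒≡ = toWitness ∘ Equivalence.from Bool.T-≡

module RootedProduct {n m : ℕ} (G : Graph (Fin n)) (H : Graph (Fin m)) (r : Fin m)
                     (H-loopless : ∀ h → H h h ≡ false) where

  adj⇒≢ : ∀ {h h′} → Adj H h h′ → h ≢ h′
  adj⇒≢ {h} hh′ refl = contradiction (trans (sym hh′) (H-loopless h)) λ ()

  data Edge : Fin n × Fin m → Fin n × Fin m → Set where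
    base : ∀ {i j} → Adj G i j → Edge (i , r) (j , r)
    copy : ∀ {i h h′} → Adj H h h′ → Edge (i , h) (i , h′)

  edge⁻ : ∀ {p p′} → Adj (rootedProduct G H r) p p′ → Edge p p′
  edge⁻ {i , h} {j , h′} e with ∨-true⁻ {eqᵇ i j ∧ H h h′} e
  ... | inj₁ ij∧hh′ with ij , hh′ ← ∧-true⁻ {eqᵇ i j} ij∧hh′ with refl ← eqᵇ⇒≡ ij = copy hh′
  ... | inj₂ rest with hr , h′r∧gij ← ∧-true⁻ {eqᵇ h r} rest with h′r , gij ← ∧-true⁻ {eqᵇ h′ r} h′r∧gij
                  with refl ← eqᵇ⇒≡ hr | refl ← eqᵇ⇒≡ h′r = base gij

  base⁺ : ∀ {i j} → Adj G i j → Adj (rootedProduct G H r) (i , r) (j , r)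
  base⁺ {i} {j} gij rewrite eqᵇ-refl r | gij = Bool.∨-zeroʳ _

  copy⁺ : ∀ {i h h′} → Adj H h h′ → Adj (rootedProduct G H r) (i , h) (i , h′)
  copy⁺ {i} hh′ rewrite eqᵇ-refl i | hh′ = refl

  module _ (K : Fin n) where

    F : Graph (VF r K)
    F = Fsub G H r K

    inF-root : ∀ i → T (inF r K (i , r))
    inF-root i = Equivalence.from (Bool.T-∨ {eqᵇ r r} {eqᵇ i K}) (inj₁ (fromWitness {a? = r ≟ r} refl))

    inF-copy : ∀ h → T (inF r K (K , h))
    inF-copy h = Equivalence.from (Bool.T-∨ {eqᵇ h r} {eqᵇ K K}) (inj₂ (fromWitness {a? = K ≟ K} refl))

    inF-off-root : ∀ {i h} → T (inF r K (i , h)) → h ≢ r → i ≡ K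
    inF-off-root {i} {h} x∈ h≢r with Equivalence.to Bool.T-∨ x∈
    ... | inj₁ h≡r = contradiction (toWitness {a? = h ≟ r} h≡r) h≢r
    ... | inj₂ i≡K = toWitness {a? = i ≟ K} i≡K

    copy-edge-index≡K : ∀ {i h h′} → T (inF r K (i , h)) → T (inF r K (i , h′)) → Adj H h h′ → i ≡ K
    copy-edge-index≡K {i} {h} x∈ u∈ hh′ with Equivalence.to Bool.T-∨ x∈
    ... | inj₁ h≡r = inF-off-root u∈ (λ h′≡r → adj⇒≢ hh′ (trans (toWitness {a? = h ≟ r} h≡r) (sym h′≡r)))
    ... | inj₂ i≡K = toWitness {a? = i ≟ K} i≡K

    VF-≡ : ∀ {u w : VF r K} → proj₁ u ≡ proj₁ w → u ≡ w
    VF-≡ {_ , u∈} {_ , w∈} refl = cong (_ ,_) (Bool.T-irrelevant u∈ w∈)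

    base-vertex : Fin n → VF r K
    base-vertex i = (i , r) , inF-root i

    copy-vertex : Fin m → VF r K
    copy-vertex h = (K , h) , inF-copy h

    base-vertex-injective : Injective _≡_ _≡_ base-vertex
    base-vertex-injective = cong (proj₁ ∘ proj₁)

    copy-vertex-injective : Injective _≡_ _≡_ copy-vertex
    copy-vertex-injective = cong (proj₂ ∘ proj₁)

    VF↪Fin : VF r K ↪ Fin (n * m)
    VF↪Fin = ↔⇒↪ (↔-sym *↔×) ↪-∘ Σ-T↪ (inF r K) (base-vertex K)

    injColorable-base : ∀ {q} → InjColorable F q → InjColorable G q
    injColorable-base = injColorable-subgraph base-vertex base-vertex-injective base⁺

    injColorable-copy : ∀ {q} → InjColorable F q → InjColorable H q
    injColorable-copy = injColorable-subgraph copy-vertex copy-vertex-injective copy⁺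

    centreNeighbours : List (VF r K)
    centreNeighbours = map base-vertex (neighbours G K) ++ map copy-vertex (neighbours H r)

    centreNeighbours-unique : Unique centreNeighbours
    centreNeighbours-unique =
      Unique.++⁺ (Unique.map⁺ base-vertex-injective (neighbours-unique G K))
                 (Unique.map⁺ copy-vertex-injective (neighbours-unique H r)) disjoint
      where
      disjoint : Disjoint (map base-vertex (neighbours G K)) (map copy-vertex (neighbours H r))
      disjoint (v∈base , v∈copy)
        with _ , _ , refl ← ∈-map⁻ base-vertex v∈base | h , h∈ , v≡ ← ∈-map⁻ copy-vertex v∈copy
        = adj⇒≢ (All.lookup (neighbours-adj H r) h∈) (cong (proj₂ ∘ proj₁) v≡)

    centreNeighbours-adj : All (Adj F (base-vertex K)) centreNeighbours
    centreNeighbours-adj = All.++⁺ (All.map⁺ (All.map base⁺ (neighbours-adj G K)))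
                                   (All.map⁺ (All.map copy⁺ (neighbours-adj H r)))

    length-centreNeighbours : length centreNeighbours ≡ deg G K + deg H r
    length-centreNeighbours =
      trans (length-++ (map base-vertex (neighbours G K)))
            (cong₂ _+_ (trans (length-map base-vertex (neighbours G K)) (length-neighbours G K))
                       (trans (length-map copy-vertex (neighbours H r)) (length-neighbours H r)))

    injColorable-centre-≤ : ∀ {q} → InjColorable F q → deg G K + deg H r ≤ q
    injColorable-centre-≤ (_ , col) =
      subst (_≤ _) length-centreNeighbours
            (injColoring-neighbourhood-≤ F {x = base-vertex K} col centreNeighbours-unique centreNeighbours-adj)

    module _ {cG cH M : ℕ} {fG : Fin n → Fin cG} {fH : Fin m → Fin cH}
             (fG-col : IsInjColoring G cG fG) (fH-col : IsInjColoring H cH fH)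
             (cG≤M : cG ≤ M) (cH≤M : cH ≤ M) (centre≤M : deg G K + deg H r ≤ M) where

      ι : Fin cG → Fin (suc M)
      ι x = inject≤ x (m≤n⇒m≤1+n cG≤M)

      ι-injective : Injective _≡_ _≡_ ι
      ι-injective = inject≤-injective _ _ _ _

      rootNeighbourColours : List (Fin cH)
      rootNeighbourColours = map fH (neighbours H r)

      centreNeighbourColours : List (Fin (suc M))
      centreNeighbourColours = map (ι ∘ fG) (neighbours G K)

      |S|+|B|≤M : length rootNeighbourColours + length centreNeighbourColours ≤ M
      |S|+|B|≤M = begin
        length rootNeighbourColours + length centreNeighbourColours
          ≡⟨ cong₂ _+_ (length-map fH (neighbours H r)) (length-map (ι ∘ fG) (neighbours G K)) ⟩
        length (neighbours H r) + length (neighbours G K)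
          ≡⟨ cong₂ _+_ (length-neighbours H r) (length-neighbours G K) ⟩
        deg H r + deg G K
          ≡⟨ +-comm (deg H r) (deg G K) ⟩
        deg G K + deg H r
          ≤⟨ centre≤M ⟩
        M ∎
        where open ≤-Reasoning

      fresh : Σ (Fin cH → Fin (suc M)) λ τ →
                Injective _≡_ _≡_ τ × (∀ x → τ x ≢ ι (fG K)) ×
                (∀ {x} → x ∈ rootNeighbourColours → τ x ∉ centreNeighbourColours)
      fresh = freshInjection cH≤M (ι (fG K)) rootNeighbourColours centreNeighbourColours |S|+|B|≤M

      τ : Fin cH → Fin (suc M)
      τ = proj₁ fresh

      τ-injective : Injective _≡_ _≡_ τ
      τ-injective = proj₁ (proj₂ fresh)

      τ-fresh : ∀ x → τ x ≢ ι (fG K)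
      τ-fresh = proj₁ (proj₂ (proj₂ fresh))

      τ-avoids : ∀ {x} → x ∈ rootNeighbourColours → τ x ∉ centreNeighbourColours
      τ-avoids = proj₂ (proj₂ (proj₂ fresh))

      colour : Fin n × Fin m → Fin (suc M)
      colour (i , h) = updateAt (τ ∘ fH) r (const (ι (fG i))) h

      colour-root : ∀ i → colour (i , r) ≡ ι (fG i)
      colour-root i = updateAt-updates r (τ ∘ fH)

      colour-off-root : ∀ {i h} → h ≢ r → colour (i , h) ≡ τ (fH h)
      colour-off-root {h = h} h≢r = updateAt-minimal h r (τ ∘ fH) h≢r

      colour-base : IsInjColoring G (suc M) (λ i → colour (i , r))
      colour-base = injColoring-resp G (sym ∘ colour-root) (injColoring-∘ G ι-injective fG-col)

      colour-copy : IsInjColoring H (suc M) (λ h → colour (K , h))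
      colour-copy = injColoring-updateAt r (injColoring-∘ H τ-injective fH-col) (τ-fresh ∘ fH)

      colour-centre : ∀ {j h} → Adj G K j → Adj H r h → colour (j , r) ≢ colour (K , h)
      colour-centre {j} {h} Kj rh e =
        τ-avoids (∈-map⁺ fH (∈-neighbours⁺ H rh))
          (subst (_∈ centreNeighbourColours) (trans (sym (colour-root j)) (trans e (colour-off-root (adj⇒≢ rh ∘ sym))))
                 (∈-map⁺ (ι ∘ fG) (∈-neighbours⁺ G Kj)))

      colour-injective : ∀ {x u w} → T (inF r K x) → T (inF r K u) → T (inF r K w) →
                         Edge x u → Edge x w → colour u ≡ colour w → u ≡ w
      colour-injective _ _ _ (base xu) (base xw) e = cong (_, r) (colour-base _ _ _ xu xw e)
      colour-injective x∈ u∈ _ (copy xu) (copy xw) e with refl ← copy-edge-index≡K x∈ u∈ xu =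
        cong (K ,_) (colour-copy _ _ _ xu xw e)
      colour-injective _ _ w∈ (base xu) (copy xw) e with refl ← inF-off-root w∈ (adj⇒≢ xw ∘ sym) =
        contradiction e (colour-centre xu xw)
      colour-injective _ u∈ _ (copy xu) (base xw) e with refl ← inF-off-root u∈ (adj⇒≢ xu ∘ sym) =
        contradiction (sym e) (colour-centre xw xu)

      injColorable-F : InjColorable F (suc M)
      injColorable-F = colour ∘ proj₁ , λ (x , x∈) (u , u∈) (w , w∈) xu xw e →
        VF-≡ (colour-injective {x} {u} {w} x∈ u∈ w∈ (edge⁻ {x} {u} xu) (edge⁻ {x} {w} xw) e)

near-max₃ : ∀ a b e {c} → a ⊔ b ⊔ e ≤ c → c ≤ suc (a ⊔ b ⊔ e) →
            c ≡ a ⊎ c ≡ b ⊎ c ≡ a + 1 ⊎ c ≡ b + 1 ⊎ c ≡ e ⊎ c ≡ e + 1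
near-max₃ a b e lo hi = choose (≡⊎≡+1 lo hi) max₃-sel
  where
  ≡⊎≡+1 : ∀ {x c} → x ≤ c → c ≤ suc x → c ≡ x ⊎ c ≡ x + 1
  ≡⊎≡+1 {x} x≤c c≤1+x with m≤n⇒m<n∨m≡n c≤1+x
  ... | inj₁ c<1+x = inj₁ (≤-antisym (s≤s⁻¹ c<1+x) x≤c)
  ... | inj₂ c≡1+x = inj₂ (trans c≡1+x (+-comm 1 x))

  max₃-sel : a ⊔ b ⊔ e ≡ a ⊎ a ⊔ b ⊔ e ≡ b ⊎ a ⊔ b ⊔ e ≡ e
  max₃-sel with ⊔-sel (a ⊔ b) e | ⊔-sel a b
  ... | inj₁ max≡a⊔b | inj₁ a⊔b≡a = inj₁ (trans max≡a⊔b a⊔b≡a)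
  ... | inj₁ max≡a⊔b | inj₂ a⊔b≡b = inj₂ (inj₁ (trans max≡a⊔b a⊔b≡b))
  ... | inj₂ max≡e   | _           = inj₂ (inj₂ max≡e)

  choose : ∀ {x c} → c ≡ x ⊎ c ≡ x + 1 → x ≡ a ⊎ x ≡ b ⊎ x ≡ e →
           c ≡ a ⊎ c ≡ b ⊎ c ≡ a + 1 ⊎ c ≡ b + 1 ⊎ c ≡ e ⊎ c ≡ e + 1
  choose (inj₁ refl) (inj₁ refl)        = inj₁ refl
  choose (inj₁ refl) (inj₂ (inj₁ refl)) = inj₂ (inj₁ refl)
  choose (inj₁ refl) (inj₂ (inj₂ refl)) = inj₂ (inj₂ (inj₂ (inj₂ (inj₁ refl))))
  choose (inj₂ refl) (inj₁ refl)        = inj₂ (inj₂ (inj₁ refl))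
  choose (inj₂ refl) (inj₂ (inj₁ refl)) = inj₂ (inj₂ (inj₂ (inj₁ refl)))
  choose (inj₂ refl) (inj₂ (inj₂ refl)) = inj₂ (inj₂ (inj₂ (inj₂ (inj₂ refl))))

lemma4p5 : (n m : ℕ) (G : Graph (Fin n)) (H : Graph (Fin m)) (r : Fin m) →
    IsSimple G → IsSimple H →
    (k : Fin n) (c : ℕ) → IsInjChrom (Fsub G H r k) c →
    (∀ (j : Fin n) (cj : ℕ) → IsInjChrom (Fsub G H r j) cj → cj ≤ c) →
    (cG cH : ℕ) → IsInjChrom G cG → IsInjChrom H cH →
    c ≡ cG ⊎ c ≡ cH ⊎ c ≡ cG + 1 ⊎ c ≡ cH + 1 ⊎
    c ≡ maxDeg G + deg H r ⊎ c ≡ maxDeg G + deg H r + 1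
lemma4p5 n m G H r _ simH k c (colF , leastF) maxF cG cH ((_ , fG-col) , leastG) ((_ , fH-col) , leastH) =
  near-max₃ cG cH Δ+d (⊔-lub (⊔-lub cG≤c cH≤c) Δ+d≤c) (leastF (suc M) (colourable k))
  where
  open RootedProduct G H r (IsSimple.irrfl simH)

  Δ+d M : ℕ
  Δ+d = maxDeg G + deg H r
  M   = cG ⊔ cH ⊔ Δ+d

  colourable : ∀ K → InjColorable (F K) (suc M)
  colourable K = injColorable-F K fG-col fH-col
    (≤-trans (m≤m⊔n cG cH) (m≤m⊔n _ Δ+d)) (≤-trans (m≤n⊔m cG cH) (m≤m⊔n _ Δ+d))
    (≤-trans (+-monoˡ-≤ (deg H r) (deg≤maxDeg G K)) (m≤n⊔m (cG ⊔ cH) Δ+d))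

  cG≤c : cG ≤ c
  cG≤c = leastG c (injColorable-base k colF)

  cH≤c : cH ≤ c
  cH≤c = leastH c (injColorable-copy k colF)

  Δ+d≤c : Δ+d ≤ c
  Δ+d≤c with K , Δ≤degK ← maxDeg-attained G k
        with cK , χK ← injChrom-exists (VF↪Fin K) (F K) (colourable K)
    = ≤-trans (+-monoˡ-≤ (deg H r) Δ≤degK) (≤-trans (injColorable-centre-≤ K (proj₁ χK)) (maxF K cK χK))
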